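{- Let $s$ be a string and suppose $s[i..|s|]$ is a palindrome for some $1\le i\le|s|$. Let $v$ be the node of $s[i..|s|]$ in the eertree of $s$. Then $s[i..|s|]$ is unique in $s$ (occurs exactly once as a substring) if and only if $\operatorname{linkcnt}(s,v)=0$ and $\mathit{cnt}(s,v)=1$.
   Context: $s[i..j]=s[i]\cdots s[j]$; a palindrome is a string equal to its reverse. For $1\le i\le|s|$, $\mathit{sufpal}(s,i)$ is the longest palindromic suffix of $s[1..i]$ and $\mathit{prepal}(s,i)$ the longest palindromic prefix of $s[i..|s|]$. The eertree of $s$ has one node for each distinct non-empty palindromic substring of $s$ plus two roots $\mathsf{even}$ (empty string) and $\mathsf{odd}$ (length $-1$); $\operatorname{str}(v)$ is the palindrome of $v$ and $\operatorname{link}(v)$ is the node of the longest proper palindromic suffix of $\operatorname{str}(v)$. $\operatorname{linkcnt}(s,v)$ is the number of nodes $u$ of the eertree of $s$ with $\operatorname{link}(u)=v$. $\mathit{cnt}(s,v)$ is the common value of $|\{1\le j\le|s|:\mathit{prepal}(s,j)=\operatorname{str}(v)\}|$ and $|\{1\le j\le|s|:\mathit{sufpal}(s,j)=\operatorname{str}(v)\}|$ (these two numbers are equal). -}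

module Defs where

open import Data.Nat using (ℕ; zero; suc; _∸_; _≤_)
open import Data.List using (List; []; _∷_; length; take; drop; reverse; filter; tails; inits; concatMap; deduplicate; upTo; map; head)
open import Data.List.Properties using (≡-dec)
open import Data.Maybe using (Maybe; just; nothing)
open import Relation.Binary.PropositionalEquality using (_≡_)
open import Relation.Binary.Definitions using (DecidableEquality)
open import Relation.Nullary using (Dec; ¬_; ¬?)

-- Strings over an alphabet A with decidable equality.  Positions in the
-- paper are 1-based; here s[1..j] = take j s and s[i..|s|] = drop (i ∸ 1) s.
module Strings {A : Set} (_≟_ : DecidableEquality A) where

  _≟ₛ_ : DecidableEquality (List A)
  _≟ₛ_ = ≡-dec _≟_

  IsPalindrome : List A → Set
  IsPalindrome w = w ≡ reverse w

  isPalindrome? : (w : List A) → Dec (IsPalindrome w)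
  isPalindrome? w = w ≟ₛ reverse w

  -- longest palindromic suffix of w ('tails' lists suffixes by decreasing
  -- length; the empty suffix is a palindrome, so the default is never used)
  longestPalSuffix : List A → List A
  longestPalSuffix w with head (filter isPalindrome? (tails w))
  ... | just u  = u
  ... | nothing = []

  sufpal : List A → ℕ → List A
  sufpal s j = longestPalSuffix (take j s)

  -- eertree suffix link of a node with non-empty palindrome u:
  -- the longest proper palindromic suffix of u (empty = the even root)
  link : List A → List A
  link []      = []
  link (_ ∷ u) = longestPalSuffix u

  factors : List A → List (List A)
  factors s = concatMap inits (tails s)

  NonEmpty : List A → Set
  NonEmpty w = ¬ (w ≡ [])

  nonEmpty? : (w : List A) → Dec (NonEmpty w)
  nonEmpty? w = ¬? (w ≟ₛ [])

  -- the non-root nodes of the eertree of s: distinct non-empty palindromic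
  -- substrings of s (a node is identified with its palindrome str(v))
  eertreeNodes : List A → List (List A)
  eertreeNodes s =
    deduplicate _≟ₛ_ (filter isPalindrome? (filter nonEmpty? (factors s)))

  -- linkcnt(s, v) with str(v) = w, for non-empty w (the two roots have
  -- root links, so they never contribute)
  linkcnt : List A → List A → ℕ
  linkcnt s w = length (filter (λ u → link u ≟ₛ w) (eertreeNodes s))

  cnt : List A → List A → ℕ
  cnt s w = length (filter (λ j → sufpal s j ≟ₛ w) (map suc (upTo (length s))))

  -- number of occurrences of w as a substring of s (0-based start positions
  -- 0..|s|; a start position counts iff the |w| letters there spell w)
  occurrences : List A → List A → ℕ
  occurrences w s =
    length (filter (λ i → take (length w) (drop i s) ≟ₛ w) (upTo (suc (length s))))

  Unique : List A → List A → Set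
  Unique w s = occurrences w s ≡ 1

-- The key property is that no palindromic factor of s has w as a proper
-- suffix.  Uniqueness of w implies it, since w would occur both as a prefix
-- and as a suffix of such a palindrome.  It is equivalent to linkcnt(s, w) = 0,
-- because the shortest such palindrome has w as its longest proper palindromic
-- suffix, i.e. as its link.  Given the property, sufpal(s, j) = w exactly when
-- an occurrence of w ends at j, so w occurs once iff cnt(s, w) = 1.
module Submission where

open import Defs
open import Data.Nat using (ℕ; zero; suc; _+_; _∸_; _≤_; _<_; s≤s; z≤n)
open import Data.Nat.Properties
  using (suc-injective; ≤-refl; ≤-trans; ≤-reflexive; ≤-pred; <⇒≢; <⇒≱; m≤m+n; m≤n+m;
         m≤n⇒m≤1+n; m≤n⇒m⊓n≡m; +-suc; +-cancelʳ-≡; +-cancelˡ-≡; +-identityʳ)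
open import Data.List using (List; []; _∷_; _++_; [_]; length; take; drop; reverse; filter; tails; inits; map; upTo)
open import Data.List.Properties
  using (++-assoc; ++-identityʳ; length-++; length-take; reverse-++; take++drop≡id;
         ∷-injectiveʳ; ++-conicalˡ; ++-conicalʳ; filter-some; filter-none)
open import Data.List.Membership.Propositional using (_∈_; find; lose)
open import Data.List.Membership.Propositional.Properties
  using (∈-map⁺; ∈-map⁻; ∈-concatMap⁺; ∈-concatMap⁻; ∈-filter⁺; ∈-filter⁻;
         ∈-deduplicate⁺; ∈-deduplicate⁻; ∈-upTo⁺; ∈-upTo⁻)
open import Data.List.Relation.Unary.All as All using ()
open import Data.List.Relation.Unary.AllPairs using (_∷_)
open import Data.List.Relation.Unary.Any using (here; there)
open import Data.List.Relation.Unary.Unique.Propositional renaming (Unique to Distinct)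
open import Data.List.Relation.Unary.Unique.Propositional.Properties using (map⁺; upTo⁺)
open import Data.Product using (_×_; _,_; ∃; ∃₂; Σ-syntax; proj₁)
open import Function.Bundles using (_⇔_; mk⇔)
open import Relation.Nullary using (¬_; yes; no; contradiction)
open import Relation.Unary using (Decidable)
open import Relation.Binary.PropositionalEquality using (_≡_; refl; sym; trans; cong; cong₂; subst; module ≡-Reasoning)
open import Relation.Binary.Definitions using (DecidableEquality)
open ≡-Reasoning

module _ {B : Set} {P : B → Set} (P? : Decidable P) where

  length-filter≡0⇒∁ : ∀ {xs x} → length (filter P? xs) ≡ 0 → x ∈ xs → ¬ P x
  length-filter≡0⇒∁ e x∈xs px = <⇒≢ (filter-some P? (lose x∈xs px)) (sym e)

  ∁⇒length-filter≡0 : ∀ {xs} → (∀ {x} → x ∈ xs → ¬ P x) → length (filter P? xs) ≡ 0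
  ∁⇒length-filter≡0 ¬p = cong length (filter-none P? (All.tabulate ¬p))

  length-filter≡1⇒≡ : ∀ {xs x y} → length (filter P? xs) ≡ 1 →
                      x ∈ xs → y ∈ xs → P x → P y → x ≡ y
  length-filter≡1⇒≡ {z ∷ xs} e x∈ y∈ px py with P? z
  length-filter≡1⇒≡ e (here refl) (here refl) px py | yes _ = refl
  length-filter≡1⇒≡ e (here refl) (there y∈) px py | yes _ =
    contradiction py (length-filter≡0⇒∁ (suc-injective e) y∈)
  length-filter≡1⇒≡ e (there x∈) y∈ px py | yes _ =
    contradiction px (length-filter≡0⇒∁ (suc-injective e) x∈)
  length-filter≡1⇒≡ e (here refl) y∈ px py | no ¬pz = contradiction px ¬pz
  length-filter≡1⇒≡ e (there x∈) (here refl) px py | no ¬pz = contradiction py ¬pz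
  length-filter≡1⇒≡ e (there x∈) (there y∈) px py | no _ = length-filter≡1⇒≡ e x∈ y∈ px py

  length-filter≡1 : ∀ {xs x} → Distinct xs → x ∈ xs → P x →
                    (∀ {y} → y ∈ xs → P y → y ≡ x) → length (filter P? xs) ≡ 1
  length-filter≡1 {z ∷ xs} (z∉xs ∷ xs!) x∈ px only with P? z | x∈
  ... | yes pz | _ = cong suc (∁⇒length-filter≡0 λ y∈ py →
    All.lookup z∉xs y∈ (trans (only (here refl) pz) (sym (only (there y∈) py))))
  ... | no ¬pz | here refl  = contradiction px ¬pz
  ... | no _   | there x∈xs = length-filter≡1 xs! x∈xs px (λ y∈ → only (there y∈))

module _ {A : Set} where

  Occurrence : List A → List A → Set
  Occurrence w s = ∃₂ λ p q → s ≡ p ++ w ++ q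

  start : ∀ {w s} → Occurrence w s → ℕ
  start (p , _ , _) = length p

  end : ∀ {w s} → Occurrence w s → ℕ
  end {w} o = start o + length w

  ++-reassoc : ∀ p t {u : List A} q → p ++ (t ++ u) ++ q ≡ (p ++ t) ++ u ++ q
  ++-reassoc p t {u} q = begin
    p ++ (t ++ u) ++ q  ≡⟨ cong (p ++_) (++-assoc t u q) ⟩
    p ++ t ++ u ++ q    ≡⟨ ++-assoc p t (u ++ q) ⟨
    (p ++ t) ++ u ++ q  ∎

  occurrence-suffix : ∀ t {u s} → Occurrence (t ++ u) s → Occurrence u s
  occurrence-suffix t (p , q , e) = p ++ t , q , trans e (++-reassoc p t q)

  prefix-occurrence : ∀ (s : List A) j → Occurrence (take j s) s
  prefix-occurrence s j = [] , drop j s , sym (take++drop≡id j s)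

  length≡0⇒≡[] : ∀ (r : List A) → length r ≡ 0 → r ≡ []
  length≡0⇒≡[] [] _ = refl

  suffix-of-longer-suffix : ∀ r₁ r₂ {u v : List A} → r₁ ++ u ≡ r₂ ++ v →
                            length u ≤ length v → ∃ λ r → v ≡ r ++ u
  suffix-of-longer-suffix r₁ [] e _ = r₁ , sym e
  suffix-of-longer-suffix [] (y ∷ r₂) {u} {v} e u≤v = contradiction u≤v (<⇒≱ v<u)
    where
    v<u : length v < length u
    v<u = subst (length v <_) (cong length (sym e))
                (s≤s (≤-trans (m≤n+m _ (length r₂)) (≤-reflexive (sym (length-++ r₂)))))
  suffix-of-longer-suffix (x ∷ r₁) (y ∷ r₂) e u≤v =
    suffix-of-longer-suffix r₁ r₂ (∷-injectiveʳ e) u≤v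

  ∈-tails⁻ : ∀ s {t : List A} → t ∈ tails s → ∃ λ p → s ≡ p ++ t
  ∈-tails⁻ []      (here refl) = [] , refl
  ∈-tails⁻ (x ∷ s) (here refl) = [] , refl
  ∈-tails⁻ (x ∷ s) (there t∈) with p , e ← ∈-tails⁻ s t∈ = x ∷ p , cong (x ∷_) e

  ∈-tails⁺ : ∀ p (t : List A) → t ∈ tails (p ++ t)
  ∈-tails⁺ []      []      = here refl
  ∈-tails⁺ []      (x ∷ t) = here refl
  ∈-tails⁺ (x ∷ p) t       = there (∈-tails⁺ p t)

  ∈-inits⁻ : ∀ t {u : List A} → u ∈ inits t → ∃ λ q → t ≡ u ++ q
  ∈-inits⁻ t (here refl) = t , refl
  ∈-inits⁻ (x ∷ t) (there u∈) with u , u∈′ , refl ← ∈-map⁻ (x ∷_) u∈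
                              with q , e ← ∈-inits⁻ t u∈′ = q , cong (x ∷_) e

  ∈-inits⁺ : ∀ u (q : List A) → u ∈ inits (u ++ q)
  ∈-inits⁺ []      q = here refl
  ∈-inits⁺ (x ∷ u) q = there (∈-map⁺ (x ∷_) (∈-inits⁺ u q))

  take-length-++ : ∀ (u v : List A) → take (length u) (u ++ v) ≡ u
  take-length-++ []      v = refl
  take-length-++ (x ∷ u) v = cong (x ∷_) (take-length-++ u v)

  drop-length-++ : ∀ (u v : List A) → drop (length u) (u ++ v) ≡ v
  drop-length-++ []      v = refl
  drop-length-++ (x ∷ u) v = drop-length-++ u v

  drop-<-nonEmpty : ∀ k (s : List A) → k < length s → ¬ drop k s ≡ []
  drop-<-nonEmpty zero    (x ∷ s) _       ()
  drop-<-nonEmpty (suc k) (x ∷ s) (s≤s k<) = drop-<-nonEmpty k s k<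

  end≤length : ∀ {w s} (o : Occurrence w s) → end o ≤ length s
  end≤length {w} (p , q , refl) = ≤-trans (m≤m+n _ (length q)) (≤-reflexive (begin
    length p + length w + length q  ≡⟨ cong (_+ length q) (length-++ p) ⟨
    length (p ++ w) + length q      ≡⟨ length-++ (p ++ w) ⟨
    length ((p ++ w) ++ q)          ≡⟨ cong length (++-assoc p w q) ⟩
    length (p ++ w ++ q)            ∎))

  occurrence⇒at-start : ∀ {w s} (o : Occurrence w s) → take (length w) (drop (start o) s) ≡ w
  occurrence⇒at-start {w} (p , q , refl) =
    trans (cong (take (length w)) (drop-length-++ p (w ++ q))) (take-length-++ w q)

  at-start⇒occurrence : ∀ (s : List A) {w} n → n ≤ length s → take (length w) (drop n s) ≡ w →
                        Σ[ o ∈ Occurrence w s ] start o ≡ n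
  at-start⇒occurrence s {w} zero _ e =
    ([] , drop (length w) s , trans (sym (take++drop≡id (length w) s)) (cong (_++ drop (length w) s) e)) , refl
  at-start⇒occurrence (x ∷ s) (suc n) (s≤s n≤) e
    with (p , q , s≡) , start≡ ← at-start⇒occurrence s n n≤ e =
    (x ∷ p , q , cong (x ∷_) s≡) , cong suc start≡

  start∈positions : ∀ {w s} (o : Occurrence w s) → start o ∈ upTo (suc (length s))
  start∈positions o = ∈-upTo⁺ (s≤s (≤-trans (m≤m+n _ _) (end≤length o)))

  end∈positions : ∀ {w s} → ¬ w ≡ [] → (o : Occurrence w s) → end o ∈ map suc (upTo (length s))
  end∈positions {[]} ne _ = contradiction refl ne
  end∈positions {x ∷ w} {s} _ o =
    subst (_∈ map suc (upTo (length s))) (sym (+-suc (start o) (length w)))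
      (∈-map⁺ suc (∈-upTo⁺ (subst (_≤ length s) (+-suc (start o) (length w)) (end≤length o))))

∈-map-suc-upTo⇒≤ : ∀ {j n} → j ∈ map suc (upTo n) → j ≤ n
∈-map-suc-upTo⇒≤ j∈ with i , i∈ , refl ← ∈-map⁻ suc j∈ = ∈-upTo⁻ i∈

module Palindromes {A : Set} (_≟_ : DecidableEquality A) where
  open Strings _≟_

  palindromic-suffix-is-prefix : ∀ r {w} → IsPalindrome (r ++ w) → IsPalindrome w →
                                 r ++ w ≡ w ++ reverse r
  palindromic-suffix-is-prefix r {w} pal pw = begin
    r ++ w                 ≡⟨ pal ⟩
    reverse (r ++ w)       ≡⟨ reverse-++ r w ⟩
    reverse w ++ reverse r ≡⟨ cong (_++ reverse r) pw ⟨
    w ++ reverse r         ∎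

  longestPalSuffix-isPalindrome : ∀ u → IsPalindrome (longestPalSuffix u)
  longestPalSuffix-isPalindrome []      = refl
  longestPalSuffix-isPalindrome (x ∷ u) with isPalindrome? (x ∷ u)
  ... | yes pal = pal
  ... | no _    = longestPalSuffix-isPalindrome u

  longestPalSuffix-suffix : ∀ u → ∃ λ r → u ≡ r ++ longestPalSuffix u
  longestPalSuffix-suffix []      = [] , refl
  longestPalSuffix-suffix (x ∷ u) with isPalindrome? (x ∷ u)
  ... | yes _ = [] , refl
  ... | no _  with r , e ← longestPalSuffix-suffix u = x ∷ r , cong (x ∷_) e

  longestPalSuffix-longest : ∀ r {w} → IsPalindrome w → length w ≤ length (longestPalSuffix (r ++ w))
  longestPalSuffix-longest [] {[]} _ = z≤n
  longestPalSuffix-longest [] {x ∷ w} pw with isPalindrome? (x ∷ w)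
  ... | yes _   = ≤-refl
  ... | no ¬pal = contradiction pw ¬pal
  longestPalSuffix-longest (y ∷ r) {w} pw with isPalindrome? (y ∷ r ++ w)
  ... | yes _ = m≤n⇒m≤1+n (≤-trans (m≤n+m _ (length r)) (≤-reflexive (sym (length-++ r))))
  ... | no _  = longestPalSuffix-longest r pw

  longestPalSuffix-endsWith : ∀ {u r w} → IsPalindrome w → u ≡ r ++ w →
                              ∃ λ r′ → longestPalSuffix u ≡ r′ ++ w
  longestPalSuffix-endsWith {u} {r} pw refl
    with r₁ , e ← longestPalSuffix-suffix u =
    suffix-of-longer-suffix r r₁ e (longestPalSuffix-longest r pw)

  ∈-factors⁻ : ∀ s {u} → u ∈ factors s → Occurrence u s
  ∈-factors⁻ s u∈ with t , t∈ , u∈t ← find (∈-concatMap⁻ inits {xs = tails s} u∈)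
                  with p , e₁ ← ∈-tails⁻ s t∈
                  with q , e₂ ← ∈-inits⁻ t u∈t = p , q , trans e₁ (cong (p ++_) e₂)

  ∈-factors⁺ : ∀ {s u} → Occurrence u s → u ∈ factors s
  ∈-factors⁺ {u = u} (p , q , refl) =
    ∈-concatMap⁺ inits (lose (∈-tails⁺ p (u ++ q)) (∈-inits⁺ u q))

  ∈-eertreeNodes⁻ : ∀ {s u} → u ∈ eertreeNodes s → NonEmpty u × IsPalindrome u × Occurrence u s
  ∈-eertreeNodes⁻ {s} u∈
    with u∈′ , pal ← ∈-filter⁻ isPalindrome? (∈-deduplicate⁻ _≟ₛ_ _ u∈)
    with u∈″ , ne ← ∈-filter⁻ nonEmpty? u∈′ = ne , pal , ∈-factors⁻ s u∈″

  ∈-eertreeNodes⁺ : ∀ {s u} → NonEmpty u → IsPalindrome u → Occurrence u s → u ∈ eertreeNodes s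
  ∈-eertreeNodes⁺ ne pal o =
    ∈-deduplicate⁺ _≟ₛ_ (∈-filter⁺ isPalindrome? (∈-filter⁺ nonEmpty? (∈-factors⁺ o) ne) pal)

  NoPalindromicExtension : List A → List A → Set
  NoPalindromicExtension w s = ∀ r → IsPalindrome (r ++ w) → Occurrence (r ++ w) s → r ≡ []

  OccursOnlyAt : List A → List A → ℕ → Set
  OccursOnlyAt w s k = ∀ (o : Occurrence w s) → start o ≡ k

  noPalindromicExtension-≡ : ∀ {w s u r} → NoPalindromicExtension w s → u ≡ r ++ w →
                             IsPalindrome u → Occurrence u s → r ≡ []
  noPalindromicExtension-≡ {r = r} noExt refl = noExt r

  occursOnlyAt⇒noPalindromicExtension : ∀ {w s k} → IsPalindrome w → OccursOnlyAt w s k →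
                                        NoPalindromicExtension w s
  occursOnlyAt⇒noPalindromicExtension {w} {s} {k} pw only r pal (p , q , e) =
    length≡0⇒≡[] r (+-cancelˡ-≡ (length p) _ _ (begin
      length p + length r  ≡⟨ length-++ p ⟨
      length (p ++ r)      ≡⟨ only (p ++ r , q , trans e (++-reassoc p r q)) ⟩
      k                    ≡⟨ only (p , reverse r ++ q , as-prefix) ⟨
      length p             ≡⟨ +-identityʳ _ ⟨
      length p + 0         ∎))
    where
    as-prefix : s ≡ p ++ w ++ reverse r ++ q
    as-prefix = begin
      s                          ≡⟨ e ⟩
      p ++ (r ++ w) ++ q         ≡⟨ cong (λ v → p ++ v ++ q) (palindromic-suffix-is-prefix r pal pw) ⟩
      p ++ (w ++ reverse r) ++ q ≡⟨ cong (p ++_) (++-assoc w (reverse r) q) ⟩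
      p ++ w ++ reverse r ++ q   ∎

  noPalindromicExtension⇒linkcnt≡0 : ∀ {w s} → NoPalindromicExtension w s → linkcnt s w ≡ 0
  noPalindromicExtension⇒linkcnt≡0 {w} {s} noExt = ∁⇒length-filter≡0 (λ u → link u ≟ₛ w) no-link
    where
    no-link : ∀ {u} → u ∈ eertreeNodes s → ¬ link u ≡ w
    no-link {[]} u∈ _ = proj₁ (∈-eertreeNodes⁻ {s} u∈) refl
    no-link {x ∷ u} u∈ link≡w
      with r , u≡ ← longestPalSuffix-suffix u
      with _ , pal , o ← ∈-eertreeNodes⁻ {s} u∈
      with () ← noPalindromicExtension-≡ noExt (cong (x ∷_) (trans u≡ (cong (r ++_) link≡w))) pal o

  -- Induction on T, for all palindromic suffixes r ++ w of T.  When r ++ w is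
  -- x ∷ T itself, the hypothesis for T shows that link (x ∷ T) = w.
  linkcnt≡0⇒noPalindromicExtension : ∀ {w s} → IsPalindrome w → linkcnt s w ≡ 0 →
                                     NoPalindromicExtension w s
  linkcnt≡0⇒noPalindromicExtension {w} {s} pw lc r pal (p , q , e) =
    extension-trivial (p ++ r ++ w) ([] , q , trans e (sym (++-assoc p (r ++ w) q))) p refl pal
    where
    no-link : ∀ {u} → NonEmpty u → IsPalindrome u → Occurrence u s → ¬ link u ≡ w
    no-link ne pu o = length-filter≡0⇒∁ (λ u → link u ≟ₛ w) lc (∈-eertreeNodes⁺ ne pu o)

    extension-trivial : ∀ T → Occurrence T s → ∀ t {r} → T ≡ t ++ r ++ w →
                        IsPalindrome (r ++ w) → r ≡ []
    extension-trivial [] _ t {r} T≡ _ = ++-conicalˡ r w (++-conicalʳ t (r ++ w) (sym T≡))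
    extension-trivial (x ∷ T) o (y ∷ t) T≡ pal =
      extension-trivial T (occurrence-suffix [ x ] o) t (∷-injectiveʳ T≡) pal
    extension-trivial (x ∷ T) o [] {[]} T≡ pal = refl
    extension-trivial (x ∷ T) o [] {y ∷ r} T≡ pal
      with r₁ , T≡r₁++ ← longestPalSuffix-suffix T
      with r′ , link≡ ← longestPalSuffix-endsWith pw (∷-injectiveʳ T≡) =
      contradiction (trans link≡ (cong (_++ w) r′≡[])) (no-link (λ ()) (subst IsPalindrome (sym T≡) pal) o)
      where
      r′≡[] : r′ ≡ []
      r′≡[] = extension-trivial T (occurrence-suffix [ x ] o) r₁ (trans T≡r₁++ (cong (r₁ ++_) link≡))
                (subst IsPalindrome link≡ (longestPalSuffix-isPalindrome T))

  noPalindromicExtension⇒longestPalSuffix : ∀ {w s u r} → IsPalindrome w → NoPalindromicExtension w s →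
                                            Occurrence u s → u ≡ r ++ w → longestPalSuffix u ≡ w
  noPalindromicExtension⇒longestPalSuffix {w} {s} {u} pw noExt o u≡
    with r₁ , u≡r₁++ ← longestPalSuffix-suffix u
    with r′ , lps≡ ← longestPalSuffix-endsWith pw u≡ =
    trans lps≡ (cong (_++ w) (noPalindromicExtension-≡ noExt lps≡
      (longestPalSuffix-isPalindrome u) (occurrence-suffix r₁ (subst (λ v → Occurrence v s) u≡r₁++ o))))

  sufpal≡⇒occurrence : ∀ {s w j} → j ≤ length s → sufpal s j ≡ w →
                       Σ[ o ∈ Occurrence w s ] end o ≡ j
  sufpal≡⇒occurrence {s} {w} {j} j≤ sufpal≡ with r , take≡r++ ← longestPalSuffix-suffix (take j s) =
    (r , drop j s , s≡) , (begin
      length r + length w  ≡⟨ length-++ r ⟨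
      length (r ++ w)      ≡⟨ cong length take≡ ⟨
      length (take j s)    ≡⟨ length-take j s ⟩
      _                    ≡⟨ m≤n⇒m⊓n≡m j≤ ⟩
      j                    ∎)
    where
    take≡ : take j s ≡ r ++ w
    take≡ = trans take≡r++ (cong (r ++_) sufpal≡)
    s≡ : s ≡ r ++ w ++ drop j s
    s≡ = begin
      s                       ≡⟨ take++drop≡id j s ⟨
      take j s ++ drop j s    ≡⟨ cong (_++ drop j s) take≡ ⟩
      (r ++ w) ++ drop j s    ≡⟨ ++-assoc r w (drop j s) ⟩
      r ++ w ++ drop j s      ∎

  occurrence⇒sufpal : ∀ {w s} → IsPalindrome w → NoPalindromicExtension w s →
                      (o : Occurrence w s) → sufpal s (end o) ≡ w
  occurrence⇒sufpal {w} {s} pw noExt o@(p , q , s≡) =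
    noPalindromicExtension⇒longestPalSuffix pw noExt (prefix-occurrence s (end o)) take≡
    where
    s≡′ : s ≡ (p ++ w) ++ q
    s≡′ = trans s≡ (sym (++-assoc p w q))
    take≡ : take (end o) s ≡ p ++ w
    take≡ = trans (cong₂ take (sym (length-++ p)) s≡′) (take-length-++ (p ++ w) q)

  unique⇒occursOnlyAt : ∀ {w s} → Unique w s → (o₀ : Occurrence w s) → OccursOnlyAt w s (start o₀)
  unique⇒occursOnlyAt {w} {s} unique o₀ o =
    length-filter≡1⇒≡ (λ i → take (length w) (drop i s) ≟ₛ w) unique
      (start∈positions o) (start∈positions o₀) (occurrence⇒at-start o) (occurrence⇒at-start o₀)

  occursOnlyAt⇒unique : ∀ {w s} (o₀ : Occurrence w s) → OccursOnlyAt w s (start o₀) → Unique w s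
  occursOnlyAt⇒unique {w} {s} o₀ only =
    length-filter≡1 (λ i → take (length w) (drop i s) ≟ₛ w) (upTo⁺ _)
      (start∈positions o₀) (occurrence⇒at-start o₀) at-start
    where
    at-start : ∀ {i} → i ∈ upTo (suc (length s)) → take (length w) (drop i s) ≡ w → i ≡ start o₀
    at-start i∈ at with o , refl ← at-start⇒occurrence s _ (≤-pred (∈-upTo⁻ i∈)) at = only o

  occursOnlyAt⇒cnt≡1 : ∀ {w s} → IsPalindrome w → NonEmpty w → (o₀ : Occurrence w s) →
                       OccursOnlyAt w s (start o₀) → cnt s w ≡ 1
  occursOnlyAt⇒cnt≡1 {w} {s} pw ne o₀ only =
    length-filter≡1 (λ j → sufpal s j ≟ₛ w) (map⁺ suc-injective (upTo⁺ _)) (end∈positions ne o₀)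
      (occurrence⇒sufpal pw (occursOnlyAt⇒noPalindromicExtension pw only) o₀) at-end
    where
    at-end : ∀ {j} → j ∈ map suc (upTo (length s)) → sufpal s j ≡ w → j ≡ end o₀
    at-end j∈ sufpal≡ with o , refl ← sufpal≡⇒occurrence (∈-map-suc-upTo⇒≤ j∈) sufpal≡ =
      cong (_+ length w) (only o)

  cnt≡1⇒occursOnlyAt : ∀ {w s} → IsPalindrome w → NonEmpty w → NoPalindromicExtension w s →
                       (o₀ : Occurrence w s) → cnt s w ≡ 1 → OccursOnlyAt w s (start o₀)
  cnt≡1⇒occursOnlyAt {w} {s} pw ne noExt o₀ c o =
    +-cancelʳ-≡ (length w) _ _ (length-filter≡1⇒≡ (λ j → sufpal s j ≟ₛ w) c
      (end∈positions ne o) (end∈positions ne o₀)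
      (occurrence⇒sufpal pw noExt o) (occurrence⇒sufpal pw noExt o₀))

lemma19 : {A : Set} (_≟_ : DecidableEquality A) (s : List A) (i : ℕ) →
          1 ≤ i → i ≤ length s →
          Strings.IsPalindrome _≟_ (drop (i ∸ 1) s) →
          (Strings.Unique _≟_ (drop (i ∸ 1) s) s ⇔
            (Strings.linkcnt _≟_ s (drop (i ∸ 1) s) ≡ 0 ×
             Strings.cnt _≟_ s (drop (i ∸ 1) s) ≡ 1))
lemma19 _≟_ s (suc k) _ k<n pw = mk⇔
  (λ unique → let only = unique⇒occursOnlyAt unique suffix in
    noPalindromicExtension⇒linkcnt≡0 (occursOnlyAt⇒noPalindromicExtension pw only) ,
    occursOnlyAt⇒cnt≡1 pw nonEmpty suffix only)
  (λ (linkcnt≡0 , cnt≡1) → occursOnlyAt⇒unique suffix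
    (cnt≡1⇒occursOnlyAt pw nonEmpty (linkcnt≡0⇒noPalindromicExtension pw linkcnt≡0) suffix cnt≡1))
  where
  open Palindromes _≟_
  suffix : Occurrence (drop k s) s
  suffix = take k s , [] , trans (sym (take++drop≡id k s)) (cong (take k s ++_) (sym (++-identityʳ (drop k s))))
  nonEmpty : Strings.NonEmpty _≟_ (drop k s)
  nonEmpty = drop-<-nonEmpty k s k<n
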